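{- Let $G$ be the graph with vertex set $\{a,b,c,d,e,f,g,h\}$ and edge set $\{ab, bc, cd, de, ef, df, cf, fg, dg, cg, bg, gh, ch, bh, ah\}$. Then at least $6$ graph modifications are needed to transform $G$ into a cluster graph.
   Context: A \emph{cluster graph} is a graph in which every connected component is a clique. A \emph{graph modification} is a vertex split, an edge addition, or an edge deletion. A \emph{vertex split} applied to a graph $G=(V,E)$ and $u\in V$ produces a graph with vertex set $(V\setminus\{u\})\cup\{v,w\}$ for new vertices $v,w$, keeping all edges not incident to $u$ and distributing the edges incident to $u$ among $v$ and $w$ so that the union of the new neighborhoods of $v$ and $w$ equals $N_G(u)$. -}

module Defs where

open import Data.Nat using (ℕ)
import Data.Nat
open import Data.Fin using (Fin; toℕ; inject₁; fromℕ; zero; suc)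
open import Data.Bool using (Bool; true; false; _∨_)
open import Data.Bool.Properties using (∨-comm)
open import Data.Product using (_×_; Σ-syntax)
open import Data.Sum using (_⊎_)
open import Relation.Nullary using (¬_)
open import Relation.Binary.PropositionalEquality using (_≡_; _≢_; refl)
open import Relation.Binary.Construct.Closure.ReflexiveTransitive using (Star)

record Graph (n : ℕ) : Set where
  field
    adj    : Fin n → Fin n → Bool
    sym    : ∀ x y → adj x y ≡ adj y x
    irrefl : ∀ x → adj x x ≡ false
open Graph public

Adj : ∀ {n} → Graph n → Fin n → Fin n → Set
Adj G x y = adj G x y ≡ true

Connected : ∀ {n} → Graph n → Fin n → Fin n → Set
Connected G = Star (Adj G)

IsCluster : ∀ {n} → Graph n → Set
IsCluster G = ∀ x y → x ≢ y → Connected G x y → Adj G x y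

SamePair : ∀ {n} → Fin n → Fin n → Fin n → Fin n → Set
SamePair x y a b = (a ≡ x × b ≡ y) ⊎ (a ≡ y × b ≡ x)

EdgeAddition : ∀ {n} → Graph n → Graph n → Set
EdgeAddition {n} G H =
  Σ' (λ x y → x ≢ y × adj G x y ≡ false ×
     (∀ a b → (SamePair x y a b → adj H a b ≡ true)
            × (¬ SamePair x y a b → adj H a b ≡ adj G a b)))
  where
  Σ' : (Fin n → Fin n → Set) → Set
  Σ' P = Σ[ x ∈ Fin n ] Σ[ y ∈ Fin n ] P x y

EdgeDeletion : ∀ {n} → Graph n → Graph n → Set
EdgeDeletion {n} G H =
  Σ' (λ x y → adj G x y ≡ true ×
     (∀ a b → (SamePair x y a b → adj H a b ≡ false)
            × (¬ SamePair x y a b → adj H a b ≡ adj G a b)))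
  where
  Σ' : (Fin n → Fin n → Set) → Set
  Σ' P = Σ[ x ∈ Fin n ] Σ[ y ∈ Fin n ] P x y

-- The result H lives on Fin (suc n): every old
-- vertex a ≠ u keeps the name inject₁ a, the new vertex v is inject₁ u and the
-- new vertex w is fromℕ n.
VertexSplit : ∀ {n} → Graph n → Fin n → Graph (Data.Nat.suc n) → Set
VertexSplit {n} G u H =
  (∀ a b → a ≢ u → b ≢ u → adj H (inject₁ a) (inject₁ b) ≡ adj G a b)
  × adj H (inject₁ u) (fromℕ n) ≡ false
  × (∀ a → a ≢ u →
       (Adj G u a → Adj H (inject₁ u) (inject₁ a) ⊎ Adj H (fromℕ n) (inject₁ a))
     × (Adj H (inject₁ u) (inject₁ a) ⊎ Adj H (fromℕ n) (inject₁ a) → Adj G u a))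

data Modification : ∀ {m n} → Graph m → Graph n → Set where
  split  : ∀ {n} {G : Graph n} {H : Graph (Data.Nat.suc n)} (u : Fin n) →
           VertexSplit G u H → Modification G H
  add    : ∀ {n} {G H : Graph n} → EdgeAddition G H → Modification G H
  delete : ∀ {n} {G H : Graph n} → EdgeDeletion G H → Modification G H

data _⟶[_]_ : ∀ {m n} → Graph m → ℕ → Graph n → Set where
  done : ∀ {n} {G : Graph n} → G ⟶[ 0 ] G
  step : ∀ {l m n k} {G : Graph l} {H : Graph m} {K : Graph n} →
         Modification G H → H ⟶[ k ] K → G ⟶[ Data.Nat.suc k ] K

-- The graph of the proposition: a,b,c,d,e,f,g,h = 0,…,7.
E : ℕ → ℕ → Bool
E 0 1 = true
E 1 2 = true
E 2 3 = true
E 3 4 = true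
E 4 5 = true
E 3 5 = true
E 2 5 = true
E 5 6 = true
E 3 6 = true
E 2 6 = true
E 1 6 = true
E 6 7 = true
E 2 7 = true
E 1 7 = true
E 0 7 = true
E _ _ = false

G₀ : Graph 8
G₀ = record
  { adj = λ x y → E (toℕ x) (toℕ y) ∨ E (toℕ y) (toℕ x)
  ; sym = λ x y → ∨-comm (E (toℕ x) (toℕ y)) (E (toℕ y) (toℕ x))
  ; irrefl = irr
  }
  where
  irr : ∀ (x : Fin 8) → E (toℕ x) (toℕ x) ∨ E (toℕ x) (toℕ x) ≡ false
  irr zero = refl
  irr (suc zero) = refl
  irr (suc (suc zero)) = refl
  irr (suc (suc (suc zero))) = refl
  irr (suc (suc (suc (suc zero)))) = refl
  irr (suc (suc (suc (suc (suc zero))))) = refl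
  irr (suc (suc (suc (suc (suc (suc zero)))))) = refl
  irr (suc (suc (suc (suc (suc (suc (suc zero))))))) = refl

{-# OPTIONS --safe #-}

-- The induced P₃s a–b–c, d–c–h, e–d–g, c–f–e, b–g–f and a–h–g of G₀ have
-- pairwise distinct centres, pairwise disjoint edge sets and pairwise distinct
-- non-edges.  A cluster graph has no induced P₃, so each of them must be
-- destroyed.  Following every vertex back to the vertex of G₀ it descends from,
-- a P₃ survives any modification that neither adds its non-edge, nor deletes
-- one of its edges, nor splits its centre; so each modification destroys at
-- most one of the six.

module Submission where

open import Defs hiding (sym)
open import Data.Bool using (true; false)
import Data.Bool.Properties as Bool
open import Data.Fin using (Fin; inject₁; fromℕ; #_)
open import Data.Fin.Properties using (_≟_; all?)
open import Data.Fin.Relation.Unary.Top using (view; view-inject₁; view-fromℕ; ‵fromℕ; ‵inject₁)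
open import Data.List using (List; []; _∷_; length; filter)
open import Data.List.Properties using (filter-all)
open import Data.List.Relation.Unary.All as All using (All; []; _∷_)
open import Data.List.Relation.Unary.All.Properties using (all-filter; filter⁺)
open import Data.List.Relation.Unary.AllPairs as AllPairs using (AllPairs; []; _∷_; allPairs?)
import Data.List.Relation.Unary.AllPairs.Properties as AllPairs
open import Data.Nat using (ℕ; suc; _≤_; z≤n; s≤s)
open import Data.Nat.Properties using (≤-reflexive; ≤-trans)
open import Data.Product using (_×_; _,_; proj₁; proj₂; ∃; ∃₂)
open import Data.Sum using (_⊎_; inj₁; inj₂; [_,_])
open import Function using (_∘_; id)
open import Level using (Level)
open import Relation.Binary.PropositionalEquality using (_≡_; _≢_; refl; sym; trans; cong)
open import Relation.Binary.Construct.Closure.ReflexiveTransitive using (ε; _◅_)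
open import Relation.Nullary using (¬_; Dec; yes; no; ¬?; contradiction)
open import Relation.Nullary.Decidable using (_×-dec_; _⊎-dec_; _→-dec_; from-yes)
open import Relation.Unary using (Pred; Decidable; ∁)
open import Relation.Unary.Properties using (∁?)

private
  variable
    a ℓ : Level
    A : Set a
    l m n k : ℕ

length≤suc-length-filter-∁ : {P : Pred A ℓ} (P? : Decidable P) {xs : List A} →
  AllPairs (λ x y → P x → ¬ P y) xs → length xs ≤ suc (length (filter (∁? P?) xs))
length≤suc-length-filter-∁ P? {[]}     []              = z≤n
length≤suc-length-filter-∁ P? {x ∷ xs} (x-excl ∷ excl) with P? x
... | yes px =
  s≤s (≤-reflexive (cong length (sym (filter-all (∁? P?) (All.map (λ excl-x → excl-x px) x-excl)))))
... | no _   = s≤s (length≤suc-length-filter-∁ P? excl)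

Adj-sym : (G : Graph n) {x y : Fin n} → Adj G x y → Adj G y x
Adj-sym G {x} {y} xy = trans (Graph.sym G y x) xy

¬Adj : (G : Graph n) {x y : Fin n} → adj G x y ≡ false → ¬ Adj G x y
¬Adj G x≁y x∼y with trans (sym x∼y) x≁y
... | ()

samePair? : (x y a b : Fin n) → Dec (SamePair x y a b)
samePair? x y a b = (a ≟ x ×-dec b ≟ y) ⊎-dec (a ≟ y ×-dec b ≟ x)

record P₃ (m : ℕ) : Set where
  constructor _─_─_
  field
    left centre right : Fin m
open P₃

infix 4 _─_─_

Edge NonEdge : P₃ m → Fin m → Fin m → Set
Edge    o a b = SamePair a b (centre o) (left o) ⊎ SamePair a b (centre o) (right o)
NonEdge o a b = SamePair a b (left o) (right o)

edge? : (o : P₃ m) (a b : Fin m) → Dec (Edge o a b)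
edge? o a b = samePair? a b (centre o) (left o) ⊎-dec samePair? a b (centre o) (right o)
nonEdge? : (o : P₃ m) (a b : Fin m) → Dec (NonEdge o a b)
nonEdge? o a b = samePair? a b (left o) (right o)

IsInducedP₃ : Graph m → P₃ m → Set
IsInducedP₃ G o = left o ≢ right o
                × Adj G (centre o) (left o) × Adj G (centre o) (right o)
                × adj G (left o) (right o) ≡ false

isInducedP₃? : (G : Graph m) → Decidable (IsInducedP₃ G)
isInducedP₃? G o = ¬? (left o ≟ right o)
  ×-dec adj G (centre o) (left o) Bool.≟ true ×-dec adj G (centre o) (right o) Bool.≟ true
  ×-dec adj G (left o) (right o) Bool.≟ false

Independent : P₃ m → P₃ m → Set
Independent o o′ = centre o ≢ centre o′
                 × (∀ a b → Edge o a b → ¬ Edge o′ a b)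
                 × (∀ a b → NonEdge o a b → ¬ NonEdge o′ a b)

independent? : (o o′ : P₃ m) → Dec (Independent o o′)
independent? o o′ = ¬? (centre o ≟ centre o′)
  ×-dec all? (λ a → all? (λ b → edge? o a b →-dec ¬? (edge? o′ a b)))
  ×-dec all? (λ a → all? (λ b → nonEdge? o a b →-dec ¬? (nonEdge? o′ a b)))

-- π sends each vertex of H to the vertex of the original graph it descends from.
data Linked (H : Graph n) (π : Fin n → Fin m) (A B : Fin m) : Set where
  link : ∀ {x y} → π x ≡ A → π y ≡ B → Adj H x y → Linked H π A B

Unlinked : Graph n → (Fin n → Fin m) → Fin m → Fin m → Set
Unlinked H π A B = ∀ x y → π x ≡ A → π y ≡ B → adj H x y ≡ false

AtMostOneOver : (Fin n → Fin m) → Fin m → Set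
AtMostOneOver π A = ∀ x y → π x ≡ A → π y ≡ A → x ≡ y

record Unresolved (H : Graph n) (π : Fin n → Fin m) (o : P₃ m) : Set where
  field
    ends-distinct  : left o ≢ right o
    centre-left    : Linked H π (centre o) (left o)
    centre-right   : Linked H π (centre o) (right o)
    ends-unlinked  : Unlinked H π (left o) (right o)
    centre-unsplit : AtMostOneOver π (centre o)
open Unresolved

induced⇒unresolved : {G : Graph m} {o : P₃ m} → IsInducedP₃ G o → Unresolved G id o
induced⇒unresolved (l≢r , c∼l , c∼r , l≁r) = record
  { ends-distinct  = l≢r
  ; centre-left    = link refl refl c∼l
  ; centre-right   = link refl refl c∼r
  ; ends-unlinked  = λ { _ _ refl refl → l≁r }
  ; centre-unsplit = λ { _ _ refl refl → refl }
  }

cluster⇒¬unresolved : {H : Graph n} {π : Fin n → Fin m} {o : P₃ m} →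
  IsCluster H → ¬ Unresolved H π o
cluster⇒¬unresolved {H = H} cl r
  with centre-left r | centre-right r
... | link {x} {y} x↦c y↦l x∼y | link {x′} {y′} x′↦c y′↦r x′∼y′
  with centre-unsplit r x x′ x↦c x′↦c
... | refl = ¬Adj H (ends-unlinked r y y′ y↦l y′↦r) (cl y y′ y≢y′ (Adj-sym H x∼y ◅ x′∼y′ ◅ ε))
  where
  y≢y′ : y ≢ y′
  y≢y′ refl = ends-distinct r (trans (sym y↦l) y′↦r)

unsplit : Fin n → Fin (suc n) → Fin n
unsplit u x with view x
... | ‵fromℕ     = u
... | ‵inject₁ a = a

unsplit-inject₁ : (u a : Fin n) → unsplit u (inject₁ a) ≡ a
unsplit-inject₁ u a rewrite view-inject₁ a = refl

unsplit-fromℕ : (u : Fin n) → unsplit u (fromℕ n) ≡ u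
unsplit-fromℕ {n} u rewrite view-fromℕ n = refl

module _ {u : Fin n} where

  data Half : Fin (suc n) → Set where
    left-half  : Half (inject₁ u)
    right-half : Half (fromℕ n)

  data Part : Fin (suc n) → Set where
    kept : ∀ {a} → a ≢ u → Part (inject₁ a)
    half : ∀ {x} → Half x → Part x

  unsplit-half : ∀ {x} → Half x → unsplit u x ≡ u
  unsplit-half left-half  = unsplit-inject₁ u u
  unsplit-half right-half = unsplit-fromℕ u

part : (u : Fin n) (x : Fin (suc n)) → Part {u = u} x
part u x with view x
... | ‵fromℕ = half right-half
... | ‵inject₁ a with a ≟ u
...   | yes refl = half left-half
...   | no a≢u   = kept a≢u

unsplit-injective : {u : Fin n} {x y : Fin (suc n)} →
  unsplit u x ≢ u → unsplit u x ≡ unsplit u y → x ≡ y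
unsplit-injective {u = u} {x} {y} x↦≢u x≡y with part u x | part u y
... | half h | _ = contradiction (unsplit-half h) x↦≢u
... | kept {a} a≢u | half h =
  contradiction (trans (sym (unsplit-inject₁ u a)) (trans x≡y (unsplit-half h))) a≢u
... | kept {a} _ | kept {b} _ =
  cong inject₁ (trans (sym (unsplit-inject₁ u a)) (trans x≡y (unsplit-inject₁ u b)))

module VertexSplitting (G : Graph n) (u : Fin n) (H : Graph (suc n)) (vs : VertexSplit G u H) where

  private
    keeps : ∀ a b → a ≢ u → b ≢ u → adj H (inject₁ a) (inject₁ b) ≡ adj G a b
    keeps = proj₁ vs

    neighbours : ∀ a → a ≢ u →
      (Adj G u a → Adj H (inject₁ u) (inject₁ a) ⊎ Adj H (fromℕ n) (inject₁ a))
      × (Adj H (inject₁ u) (inject₁ a) ⊎ Adj H (fromℕ n) (inject₁ a) → Adj G u a)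
    neighbours = proj₂ (proj₂ vs)

  halves-nonadjacent : ∀ {x y} → Half {u = u} x → Half {u = u} y → adj H x y ≡ false
  halves-nonadjacent left-half  left-half  = irrefl H _
  halves-nonadjacent left-half  right-half = proj₁ (proj₂ vs)
  halves-nonadjacent right-half left-half  = trans (Graph.sym H _ _) (proj₁ (proj₂ vs))
  halves-nonadjacent right-half right-half = irrefl H _

  half-neighbour : ∀ {h a} → Half {u = u} h → a ≢ u → Adj H h (inject₁ a) → Adj G u a
  half-neighbour left-half  a≢u h∼a = proj₂ (neighbours _ a≢u) (inj₁ h∼a)
  half-neighbour right-half a≢u h∼a = proj₂ (neighbours _ a≢u) (inj₂ h∼a)

  neighbour-half : ∀ {a} → a ≢ u → Adj G u a → ∃ λ h → Half {u = u} h × Adj H h (inject₁ a)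
  neighbour-half a≢u u∼a =
    [ (λ e → _ , left-half , e) , (λ e → _ , right-half , e) ] (proj₁ (neighbours _ a≢u) u∼a)

  unsplit-edge : ∀ {x y} → Adj H x y → Adj G (unsplit u x) (unsplit u y)
  unsplit-edge {x} {y} x∼y with part u x | part u y
  ... | kept {a} a≢u | kept {b} b≢u
    rewrite unsplit-inject₁ u a | unsplit-inject₁ u b = trans (sym (keeps a b a≢u b≢u)) x∼y
  ... | half h | kept {b} b≢u
    rewrite unsplit-half h | unsplit-inject₁ u b = half-neighbour h b≢u x∼y
  ... | kept {a} a≢u | half h
    rewrite unsplit-half h | unsplit-inject₁ u a = Adj-sym G (half-neighbour h a≢u (Adj-sym H x∼y))
  ... | half h | half h′ = contradiction x∼y (¬Adj H (halves-nonadjacent h h′))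

  lift-edge : ∀ {a b} → Adj G a b → ∃₂ λ x y → unsplit u x ≡ a × unsplit u y ≡ b × Adj H x y
  lift-edge {a} {b} a∼b with a ≟ u | b ≟ u
  ... | yes refl | yes refl = contradiction a∼b (¬Adj G (irrefl G u))
  ... | no a≢u | no b≢u =
    _ , _ , unsplit-inject₁ u a , unsplit-inject₁ u b , trans (keeps a b a≢u b≢u) a∼b
  ... | yes refl | no b≢u with neighbour-half b≢u a∼b
  ...   | h , h-half , h∼b = h , _ , unsplit-half h-half , unsplit-inject₁ u b , h∼b
  lift-edge {a} a∼b | no a≢u | yes refl with neighbour-half a≢u (Adj-sym G a∼b)
  ...   | h , h-half , h∼a = _ , h , unsplit-inject₁ u a , unsplit-half h-half , Adj-sym H h∼a

  module _ {π : Fin n → Fin m} where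

    unsplit-linked : ∀ {A B} → Linked G π A B → Linked H (π ∘ unsplit u) A B
    unsplit-linked (link a↦ b↦ a∼b) with lift-edge a∼b
    ... | _ , _ , x↦a , y↦b , x∼y = link (trans (cong π x↦a) a↦) (trans (cong π y↦b) b↦) x∼y

    unsplit-unlinked : ∀ {A B} → Unlinked G π A B → Unlinked H (π ∘ unsplit u) A B
    unsplit-unlinked a≁b x y x↦ y↦ = Bool.¬-not λ x∼y → ¬Adj G (a≁b _ _ x↦ y↦) (unsplit-edge x∼y)

    unsplit-atMostOneOver : ∀ {A} → π u ≢ A → AtMostOneOver π A → AtMostOneOver (π ∘ unsplit u) A
    unsplit-atMostOneOver πu≢A one x y x↦ y↦ =
      unsplit-injective (λ x↦u → πu≢A (trans (cong π (sym x↦u)) x↦)) (one _ _ x↦ y↦)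

Hits : {G : Graph l} {H : Graph n} → (Fin l → Fin m) → Modification G H → P₃ m → Set
Hits π (split u _)          o = π u ≡ centre o
Hits π (add (x , y , _))    o = NonEdge o (π x) (π y)
Hits π (delete (x , y , _)) o = Edge o (π x) (π y)

hits? : {G : Graph l} {H : Graph n} (π : Fin l → Fin m) (μ : Modification G H) → Decidable (Hits π μ)
hits? π (split u _)          o = π u ≟ centre o
hits? π (add (x , y , _))    o = nonEdge? o (π x) (π y)
hits? π (delete (x , y , _)) o = edge? o (π x) (π y)

independent⇒¬both-hit : {G : Graph l} {H : Graph n} {π : Fin l → Fin m} (μ : Modification G H) →
  ∀ {o o′} → Independent o o′ → Hits π μ o → ¬ Hits π μ o′
independent⇒¬both-hit (split _ _)  (c≢c′ , _ , _) hit hit′ = c≢c′ (trans (sym hit) hit′)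
independent⇒¬both-hit (add _)      (_ , _ , disjoint) hit hit′ = disjoint _ _ hit hit′
independent⇒¬both-hit (delete _)   (_ , disjoint , _) hit hit′ = disjoint _ _ hit hit′

project : {G : Graph l} {H : Graph n} → Modification G H → (Fin l → Fin m) → Fin n → Fin m
project (split u _) π = π ∘ unsplit u
project (add _)     π = π
project (delete _)  π = π

off-pair : {π : Fin n → Fin m} {x y a b : Fin n} {A B : Fin m} →
  ¬ SamePair (π x) (π y) A B → π a ≡ A → π b ≡ B → ¬ SamePair x y a b
off-pair ¬p refl refl (inj₁ (refl , refl)) = ¬p (inj₁ (refl , refl))
off-pair ¬p refl refl (inj₂ (refl , refl)) = ¬p (inj₂ (refl , refl))

linked-map : {G H : Graph n} {π : Fin n → Fin m} {A B : Fin m} →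
  (∀ {a b} → π a ≡ A → π b ≡ B → Adj G a b → Adj H a b) → Linked G π A B → Linked H π A B
linked-map f (link a↦ b↦ a∼b) = link a↦ b↦ (f a↦ b↦ a∼b)

addition-keeps-edges : {G H : Graph n} → EdgeAddition G H → ∀ {a b} → Adj G a b → Adj H a b
addition-keeps-edges (x , y , _ , _ , spec) {a} {b} a∼b with samePair? x y a b
... | yes added = proj₁ (spec a b) added
... | no ¬added = trans (proj₂ (spec a b) ¬added) a∼b

deletion-keeps-non-edges : {G H : Graph n} → EdgeDeletion G H →
  ∀ {a b} → adj G a b ≡ false → adj H a b ≡ false
deletion-keeps-non-edges (x , y , _ , spec) {a} {b} a≁b with samePair? x y a b
... | yes deleted = proj₁ (spec a b) deleted
... | no ¬deleted = trans (proj₂ (spec a b) ¬deleted) a≁b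

survives : {G : Graph l} {H : Graph n} {π : Fin l → Fin m} {o : P₃ m} (μ : Modification G H) →
  ¬ Hits π μ o → Unresolved G π o → Unresolved H (project μ π) o
survives {G = G} {H} {π} (split u vs) ¬hit r = record
  { ends-distinct  = ends-distinct r
  ; centre-left    = unsplit-linked (centre-left r)
  ; centre-right   = unsplit-linked (centre-right r)
  ; ends-unlinked  = unsplit-unlinked {π = π} (ends-unlinked r)
  ; centre-unsplit = unsplit-atMostOneOver ¬hit (centre-unsplit r)
  }
  where open VertexSplitting G u H vs
survives {G = G} {H} (add α@(_ , _ , _ , _ , spec)) ¬hit r = record
  { ends-distinct  = ends-distinct r
  ; centre-left    = linked-map (λ _ _ → addition-keeps-edges {G = G} {H} α) (centre-left r)
  ; centre-right   = linked-map (λ _ _ → addition-keeps-edges {G = G} {H} α) (centre-right r)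
  ; ends-unlinked  = λ a b a↦ b↦ →
      trans (proj₂ (spec a b) (off-pair ¬hit a↦ b↦)) (ends-unlinked r a b a↦ b↦)
  ; centre-unsplit = centre-unsplit r
  }
survives {G = G} {H} {π} (delete δ@(x , y , _ , spec)) ¬hit r = record
  { ends-distinct  = ends-distinct r
  ; centre-left    = linked-map (undeleted (¬hit ∘ inj₁)) (centre-left r)
  ; centre-right   = linked-map (undeleted (¬hit ∘ inj₂)) (centre-right r)
  ; ends-unlinked  = λ a b a↦ b↦ →
      deletion-keeps-non-edges {G = G} {H} δ (ends-unlinked r a b a↦ b↦)
  ; centre-unsplit = centre-unsplit r
  }
  where
  undeleted : ∀ {A B a b} → ¬ SamePair (π x) (π y) A B → π a ≡ A → π b ≡ B → Adj G a b → Adj H a b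
  undeleted ¬deleted a↦ b↦ = trans (proj₂ (spec _ _) (off-pair ¬deleted a↦ b↦))

packing-lower-bound : {G : Graph l} {H : Graph n} → G ⟶[ k ] H → IsCluster H →
  (π : Fin l → Fin m) (os : List (P₃ m)) →
  AllPairs Independent os → All (Unresolved G π) os → length os ≤ k
packing-lower-bound done cl π []      _ _       = z≤n
packing-lower-bound done cl π (_ ∷ _) _ (r ∷ _) = contradiction r (cluster⇒¬unresolved cl)
packing-lower-bound (step μ rest) cl π os independent unresolved = ≤-trans
  (length≤suc-length-filter-∁ (hits? π μ) (AllPairs.map (independent⇒¬both-hit μ) independent))
  (s≤s (packing-lower-bound rest cl (project μ π) (filter unhit? os)
          (AllPairs.filter⁺ unhit? independent)
          (All.zipWith (λ (¬hit , r) → survives μ ¬hit r)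
                       (all-filter unhit? os , filter⁺ unhit? unresolved))))
  where
  unhit? : Decidable (∁ (Hits π μ))
  unhit? = ∁? (hits? π μ)

obstructions : List (P₃ 8)
obstructions = (# 0 ─ # 1 ─ # 2) ∷ (# 3 ─ # 2 ─ # 7) ∷ (# 4 ─ # 3 ─ # 6)
             ∷ (# 2 ─ # 5 ─ # 4) ∷ (# 1 ─ # 6 ─ # 5) ∷ (# 0 ─ # 7 ─ # 6) ∷ []

proposition1 : ∀ {n} (H : Graph n) (k : ℕ) → G₀ ⟶[ k ] H → IsCluster H → 6 ≤ k
proposition1 H k G₀⟶H cluster = packing-lower-bound G₀⟶H cluster id obstructions
  (from-yes (allPairs? independent? obstructions))
  (All.map induced⇒unresolved (from-yes (All.all? (isInducedP₃? G₀) obstructions)))
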